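{- Let $L$ be a lattice that has no doubly reducible elements, and let $a_1, a_2, a_3, b_1, b_2, b_3$ be six distinct elements of $L$ such that $a_1 < a_2 < a_3$, $b_1 < b_2 < b_3$, $a_1 < b_3$, and $b_1 < a_3$. Assume moreover that $a_2 \parallel b_i$ for all $1 \leq i \leq 3$, that $a_i \parallel b_2$ for all $1 \leq i \leq 3$, that $a_2 \vee b_2 = a_3 \vee b_3$, and that $a_2 \wedge b_2 = a_1 \wedge b_1$. Then $L$ has a sublattice that is isomorphic to $L_{15}$.
   Context: For elements $x,y$ of a poset, $x \parallel y$ means that neither $x \leq y$ nor $y \leq x$ holds. An element $x$ of a lattice $L$ is doubly reducible if there exist $x_1,x_2,x_3,x_4 \in L$ with $x_1 \parallel x_2$, $x_3 \parallel x_4$ and $x = x_1 \vee x_2 = x_3 \wedge x_4$. The lattice $L_{15}$ (from McKenzie's list) is the ten-element lattice with elements $0, h, i, e, f, g, d, b, c, 1$ whose covering relations are exactly: $h$ and $i$ cover $0$; $e$ covers $h$; $f$ covers $h$ and $i$; $g$ covers $i$; $d$ covers $f$; $b$ covers $e$ and $d$; $c$ covers $d$ and $g$; $1$ covers $b$ and $c$. -}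

module Defs where

open import Level using (Level; _⊔_)
open import Data.Bool using (Bool; true; false; T)
open import Data.Product using (_×_; ∃-syntax)
open import Relation.Nullary using (¬_)
open import Relation.Binary.PropositionalEquality using (_≡_)
open import Relation.Binary.Lattice.Bundles using (Lattice)

module _ {c ℓ₁ ℓ₂ : Level} (L : Lattice c ℓ₁ ℓ₂) where
  open Lattice L

  _<L_ : Carrier → Carrier → Set (ℓ₁ ⊔ ℓ₂)
  x <L y = x ≤ y × ¬ (x ≈ y)

  _∥_ : Carrier → Carrier → Set ℓ₂
  x ∥ y = ¬ (x ≤ y) × ¬ (y ≤ x)

  DoublyReducible : Carrier → Set (c ⊔ ℓ₁ ⊔ ℓ₂)
  DoublyReducible x = ∃[ x₁ ] ∃[ x₂ ] ∃[ x₃ ] ∃[ x₄ ]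
    (x₁ ∥ x₂ × x₃ ∥ x₄ × x ≈ (x₁ ∨ x₂) × x ≈ (x₃ ∧ x₄))

  NoDoublyReducible : Set (c ⊔ ℓ₁ ⊔ ℓ₂)
  NoDoublyReducible = ∀ x → ¬ DoublyReducible x

data L15 : Set where
  `0 `h `i `e `f `g `d `b `c `1 : L15

le15 : L15 → L15 → Bool
le15 `0 _ = true
le15 `h `h = true
le15 `h `e = true
le15 `h `f = true
le15 `h `d = true
le15 `h `b = true
le15 `h `c = true
le15 `h `1 = true
le15 `i `i = true
le15 `i `f = true
le15 `i `g = true
le15 `i `d = true
le15 `i `b = true
le15 `i `c = true
le15 `i `1 = true
le15 `e `e = true
le15 `e `b = true
le15 `e `1 = true
le15 `f `f = true
le15 `f `d = true
le15 `f `b = true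
le15 `f `c = true
le15 `f `1 = true
le15 `g `g = true
le15 `g `c = true
le15 `g `1 = true
le15 `d `d = true
le15 `d `b = true
le15 `d `c = true
le15 `d `1 = true
le15 `b `b = true
le15 `b `1 = true
le15 `c `c = true
le15 `c `1 = true
le15 `1 `1 = true
le15 _ _ = false

_≤₁₅_ : L15 → L15 → Set
x ≤₁₅ y = T (le15 x y)

IsJoin₁₅ : L15 → L15 → L15 → Set
IsJoin₁₅ x y z = x ≤₁₅ z × y ≤₁₅ z × (∀ w → x ≤₁₅ w → y ≤₁₅ w → z ≤₁₅ w)

IsMeet₁₅ : L15 → L15 → L15 → Set
IsMeet₁₅ x y z = z ≤₁₅ x × z ≤₁₅ y × (∀ w → w ≤₁₅ x → w ≤₁₅ y → w ≤₁₅ z)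

-- A lattice embedding L15 ↪ L; its image is a sublattice of L isomorphic
-- to L15, and every such sublattice arises this way.
record L15Embedding {c ℓ₁ ℓ₂ : Level} (L : Lattice c ℓ₁ ℓ₂) : Set (c ⊔ ℓ₁) where
  open Lattice L
  field
    emb       : L15 → Carrier
    injective : ∀ x y → emb x ≈ emb y → x ≡ y
    pres-∨    : ∀ x y z → IsJoin₁₅ x y z → emb z ≈ (emb x ∨ emb y)
    pres-∧    : ∀ x y z → IsMeet₁₅ x y z → emb z ≈ (emb x ∧ emb y)

HasL15Sublattice : {c ℓ₁ ℓ₂ : Level} (L : Lattice c ℓ₁ ℓ₂) → Set (c ⊔ ℓ₁)
HasL15Sublattice L = L15Embedding L

module Submission where

-- With h = a₂ ∧ b₃ and i = a₃ ∧ b₂ (so a₁ ≤ h and b₁ ≤ i), the elements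
--   0 = a₂ ∧ b₂, e = a₂, g = b₂, f = h ∨ i, b = a₂ ∨ i, c = b₂ ∨ h, d = b ∧ c, 1 = a₂ ∨ b₂
-- form a copy of L15. Monotonicity is immediate, and all joins and meets of L15 follow
-- from the defining ones above together with a₂ ∧ c ≤ h and b ∧ b₂ ≤ i (which hold as
-- c ≤ b₃ and b ≤ a₃). Distinct elements are kept apart by the incomparabilities of the
-- chains, except d and f: if d ≤ f, then f = h ∨ i = b ∧ c would be doubly reducible.

open import Defs
open import Level using (Level)
open import Data.Bool using (Bool; true; T; not) renaming (_∧_ to _&&_; _∨_ to _||_)
open import Data.Bool.ListAction using (all; any)
open import Data.Bool.Properties using (T-∧; T-∨)
open import Data.Empty using (⊥; ⊥-elim)
open import Data.List using (List; []; _∷_)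
open import Data.List.Membership.Propositional using (_∈_)
open import Data.List.Relation.Unary.All using (All; []; _∷_; lookup; lookupWith)
open import Data.List.Relation.Unary.All.Properties using (all⁺)
open import Data.List.Relation.Unary.Any using (here; there)
open import Data.List.Relation.Unary.Any.Properties using (any⁻)
open import Data.Nat using (ℕ; zero; suc; _≡ᵇ_)
open import Data.Nat.Properties using (≡ᵇ⇒≡)
open import Data.Product using (_×_; _,_)
open import Data.Sum using (_⊎_; inj₁; inj₂)
open import Function.Bundles using (module Equivalence)
open import Relation.Nullary using (¬_)
open import Relation.Binary.PropositionalEquality as ≡ using (_≡_; refl; cong)
open import Relation.Binary.Lattice.Bundles using (Lattice)

open Equivalence using (to)

elements : List L15
elements = `0 ∷ `h ∷ `i ∷ `e ∷ `f ∷ `g ∷ `d ∷ `b ∷ `c ∷ `1 ∷ []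

∈-elements : ∀ x → x ∈ elements
∈-elements `0 = here refl
∈-elements `h = there (here refl)
∈-elements `i = there (there (here refl))
∈-elements `e = there (there (there (here refl)))
∈-elements `f = there (there (there (there (here refl))))
∈-elements `g = there (there (there (there (there (here refl)))))
∈-elements `d = there (there (there (there (there (there (here refl))))))
∈-elements `b = there (there (there (there (there (there (there (here refl)))))))
∈-elements `c = there (there (there (there (there (there (there (there (here refl))))))))
∈-elements `1 = there (there (there (there (there (there (there (there (there (here refl)))))))))

every : (L15 → Bool) → Bool
every p = all p elements

every-sound : ∀ p → T (every p) → ∀ x → T (p x)
every-sound p h x = lookup (all⁺ p elements h) (∈-elements x)

every₂ : (L15 → L15 → Bool) → Bool
every₂ p = every λ x → every (p x)

every₂-sound : ∀ p → T (every₂ p) → ∀ x y → T (p x y)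
every₂-sound p h x = every-sound (p x) (every-sound (λ x → every (p x)) h x)

_⇒ᵇ_ : Bool → Bool → Bool
p ⇒ᵇ q = not p || q

T-⇒ : ∀ {p q} → T (p ⇒ᵇ q) → T p → T q
T-⇒ {true} h _ = h

index : L15 → ℕ
index `0 = 0
index `h = 1
index `i = 2
index `e = 3
index `f = 4
index `g = 5
index `d = 6
index `b = 7
index `c = 8
index `1 = 9

fromIndex : ℕ → L15
fromIndex 0 = `0
fromIndex 1 = `h
fromIndex 2 = `i
fromIndex 3 = `e
fromIndex 4 = `f
fromIndex 5 = `g
fromIndex 6 = `d
fromIndex 7 = `b
fromIndex 8 = `c
fromIndex _ = `1

fromIndex-index : ∀ x → fromIndex (index x) ≡ x
fromIndex-index `0 = refl
fromIndex-index `h = refl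
fromIndex-index `i = refl
fromIndex-index `e = refl
fromIndex-index `f = refl
fromIndex-index `g = refl
fromIndex-index `d = refl
fromIndex-index `b = refl
fromIndex-index `c = refl
fromIndex-index `1 = refl

_==_ : L15 → L15 → Bool
x == y = index x ≡ᵇ index y

==⇒≡ : ∀ x y → T (x == y) → x ≡ y
==⇒≡ x y eq = ≡.trans (≡.sym (fromIndex-index x))
  (≡.trans (cong fromIndex (≡ᵇ⇒≡ (index x) (index y) eq)) (fromIndex-index y))

-- Here and below, facts about L15 are proved by evaluation: the omitted proof of the
-- boolean check is tt, found by normalising it.
≤₁₅-refl : ∀ x → x ≤₁₅ x
≤₁₅-refl = every-sound (λ x → le15 x x) _

upperCovers : L15 → List L15
upperCovers `0 = `h ∷ `i ∷ []
upperCovers `h = `e ∷ `f ∷ []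
upperCovers `i = `f ∷ `g ∷ []
upperCovers `e = `b ∷ []
upperCovers `f = `d ∷ []
upperCovers `g = `c ∷ []
upperCovers `d = `b ∷ `c ∷ []
upperCovers `b = `1 ∷ []
upperCovers `c = `1 ∷ []
upperCovers `1 = []

reaches : ℕ → L15 → L15 → Bool
reaches zero    x y = x == y
reaches (suc n) x y = x == y || any (λ z → reaches n z y) (upperCovers x)

-- 5 is the length of the longest chain of L15.
≤₁₅⇒reaches : ∀ x y → x ≤₁₅ y → T (reaches 5 x y)
≤₁₅⇒reaches x y = T-⇒ (every₂-sound (λ x y → le15 x y ⇒ᵇ reaches 5 x y) _ x y)

-- A triple (u , v , w) stands for the lattice inequality w ≤ u ∨ v (resp. u ∧ v ≤ w).
-- The join of incomparable x and y is bounded through such a triple when x, y ≤ w and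
-- {u , v} lies below {x , y}; dually for meets.
joinBasis : List (L15 × L15 × L15)
joinBasis = (`h , `i , `f) ∷ (`e , `i , `b) ∷ (`g , `h , `c) ∷ (`e , `g , `1) ∷ []

meetBasis : List (L15 × L15 × L15)
meetBasis = (`e , `g , `0) ∷ (`b , `c , `d) ∷ (`e , `c , `h) ∷ (`b , `g , `i) ∷ []

separatingPairs : List (L15 × L15)
separatingPairs = (`h , `g) ∷ (`i , `e) ∷ (`e , `c) ∷ (`g , `b) ∷ (`d , `f) ∷ []

boundsJoin : L15 → L15 → L15 × L15 × L15 → Bool
boundsJoin x y (u , v , w) =
  le15 x w && le15 y w && (le15 u x && le15 v y || le15 u y && le15 v x)

boundsMeet : L15 → L15 → L15 × L15 × L15 → Bool
boundsMeet x y (u , v , w) =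
  le15 w x && le15 w y && (le15 x u && le15 y v || le15 y u && le15 x v)

separates : L15 → L15 → L15 × L15 → Bool
separates x y (s , t) = le15 s x && le15 y t || le15 s y && le15 x t

joinBasis-complete : ∀ x y → T (le15 x y || le15 y x || any (boundsJoin x y) joinBasis)
joinBasis-complete = every₂-sound _ _

meetBasis-complete : ∀ x y → T (le15 x y || le15 y x || any (boundsMeet x y) meetBasis)
meetBasis-complete = every₂-sound _ _

separatingPairs-complete : ∀ x y → T (x == y || any (separates x y) separatingPairs)
separatingPairs-complete = every₂-sound _ _

module _ {a ℓ₁ ℓ₂ : Level} (L : Lattice a ℓ₁ ℓ₂) (f : L15 → Lattice.Carrier L) where
  open Lattice L renaming (refl to ≤-refl)
  open import Relation.Binary.Lattice.Properties.JoinSemilattice joinSemilattice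
    using (∨-monotonic; ∨-comm)
  open import Relation.Binary.Lattice.Properties.MeetSemilattice meetSemilattice
    using (∧-monotonic; ∧-comm)

  JoinBound : L15 × L15 × L15 → Set ℓ₂
  JoinBound (u , v , w) = f w ≤ f u ∨ f v

  MeetBound : L15 × L15 × L15 → Set ℓ₂
  MeetBound (u , v , w) = f u ∧ f v ≤ f w

  Separated : L15 × L15 → Set ℓ₂
  Separated (s , t) = ¬ f s ≤ f t

  record L15EmbeddingCriterion : Set ℓ₂ where
    field
      covers-preserved  : ∀ x → All (λ y → f x ≤ f y) (upperCovers x)
      joinBasis-bounded : All JoinBound joinBasis
      meetBasis-bounded : All MeetBound meetBasis
      pairs-separated   : All Separated separatingPairs

  module _ (criterion : L15EmbeddingCriterion) where
    open L15EmbeddingCriterion criterion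

    reaches-monotone : ∀ n x y → T (reaches n x y) → f x ≤ f y
    reaches-monotone zero x y x==y rewrite ==⇒≡ x y x==y = ≤-refl
    reaches-monotone (suc n) x y h with to T-∨ h
    ... | inj₁ x==y rewrite ==⇒≡ x y x==y = ≤-refl
    ... | inj₂ step = lookupWith cover-then-reach (covers-preserved x) (any⁻ _ _ step)
      where
      cover-then-reach : ∀ {z} → f x ≤ f z → T (reaches n z y) → f x ≤ f y
      cover-then-reach {z} fx≤fz z↝y = trans fx≤fz (reaches-monotone n z y z↝y)

    monotone : ∀ {x y} → x ≤₁₅ y → f x ≤ f y
    monotone {x} {y} x≤y = reaches-monotone 5 x y (≤₁₅⇒reaches x y x≤y)

    join-below : ∀ {x y z} → IsJoin₁₅ x y z → f z ≤ f x ∨ f y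
    join-below {x} {y} {z} (_ , _ , least) with to T-∨ (joinBasis-complete x y)
    ... | inj₁ x≤y = trans (monotone (least y x≤y (≤₁₅-refl y))) (y≤x∨y _ _)
    ... | inj₂ h with to T-∨ h
    ...   | inj₁ y≤x = trans (monotone (least x (≤₁₅-refl x) y≤x)) (x≤x∨y _ _)
    ...   | inj₂ h′ = lookupWith via-basis joinBasis-bounded (any⁻ _ _ h′)
      where
      via-basis : ∀ {t} → JoinBound t → T (boundsJoin x y t) → f z ≤ f x ∨ f y
      via-basis {u , v , w} fw≤fu∨fv bounds with to T-∧ bounds
      ... | x≤w , rest with to T-∧ rest
      ... | y≤w , order =
        trans (monotone (least w x≤w y≤w)) (trans fw≤fu∨fv (fu∨fv≤fx∨fy (to T-∨ order)))
        where
        fu∨fv≤fx∨fy : T (le15 u x && le15 v y) ⊎ T (le15 u y && le15 v x) →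
                      f u ∨ f v ≤ f x ∨ f y
        fu∨fv≤fx∨fy (inj₁ uv) = let u≤x , v≤y = to T-∧ uv in
          ∨-monotonic (monotone u≤x) (monotone v≤y)
        fu∨fv≤fx∨fy (inj₂ uv) = let u≤y , v≤x = to T-∧ uv in
          trans (∨-monotonic (monotone u≤y) (monotone v≤x)) (reflexive (∨-comm _ _))

    meet-above : ∀ {x y z} → IsMeet₁₅ x y z → f x ∧ f y ≤ f z
    meet-above {x} {y} {z} (_ , _ , greatest) with to T-∨ (meetBasis-complete x y)
    ... | inj₁ x≤y = trans (x∧y≤x _ _) (monotone (greatest x (≤₁₅-refl x) x≤y))
    ... | inj₂ h with to T-∨ h
    ...   | inj₁ y≤x = trans (x∧y≤y _ _) (monotone (greatest y y≤x (≤₁₅-refl y)))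
    ...   | inj₂ h′ = lookupWith via-basis meetBasis-bounded (any⁻ _ _ h′)
      where
      via-basis : ∀ {t} → MeetBound t → T (boundsMeet x y t) → f x ∧ f y ≤ f z
      via-basis {u , v , w} fu∧fv≤fw bounds with to T-∧ bounds
      ... | w≤x , rest with to T-∧ rest
      ... | w≤y , order =
        trans (fx∧fy≤fu∧fv (to T-∨ order)) (trans fu∧fv≤fw (monotone (greatest w w≤x w≤y)))
        where
        fx∧fy≤fu∧fv : T (le15 x u && le15 y v) ⊎ T (le15 y u && le15 x v) →
                      f x ∧ f y ≤ f u ∧ f v
        fx∧fy≤fu∧fv (inj₁ xy) = let x≤u , y≤v = to T-∧ xy in
          ∧-monotonic (monotone x≤u) (monotone y≤v)
        fx∧fy≤fu∧fv (inj₂ xy) = let y≤u , x≤v = to T-∧ xy in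
          trans (reflexive (∧-comm _ _)) (∧-monotonic (monotone y≤u) (monotone x≤v))

    injective : ∀ x y → f x ≈ f y → x ≡ y
    injective x y fx≈fy with to T-∨ (separatingPairs-complete x y)
    ... | inj₁ x==y = ==⇒≡ x y x==y
    ... | inj₂ h = ⊥-elim (lookupWith contradiction pairs-separated (any⁻ _ _ h))
      where
      contradiction : ∀ {st} → Separated st → T (separates x y st) → ⊥
      contradiction {s , t} fs≰ft sep with to T-∨ sep
      ... | inj₁ st = let s≤x , y≤t = to T-∧ st in
        fs≰ft (trans (monotone s≤x) (trans (reflexive fx≈fy) (monotone y≤t)))
      ... | inj₂ st = let s≤y , x≤t = to T-∧ st in
        fs≰ft (trans (monotone s≤y) (trans (reflexive (Eq.sym fx≈fy)) (monotone x≤t)))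

    criterion⇒embedding : L15Embedding L
    criterion⇒embedding = record
      { emb       = f
      ; injective = injective
      ; pres-∨    = λ { x y z J@(x≤z , y≤z , _) →
                      antisym (join-below J) (∨-least (monotone x≤z) (monotone y≤z)) }
      ; pres-∧    = λ { x y z M@(z≤x , z≤y , _) →
                      antisym (∧-greatest (monotone z≤x) (monotone z≤y)) (meet-above M) }
      }

module CrossingChains {a ℓ₁ ℓ₂ : Level} (L : Lattice a ℓ₁ ℓ₂) where
  open Lattice L renaming (refl to ≤-refl)

  module _
    (no-doubly-reducible : NoDoublyReducible L)
    {a₁ a₂ a₃ b₁ b₂ b₃ : Carrier}
    (a₁≤a₂ : a₁ ≤ a₂) (a₂≤a₃ : a₂ ≤ a₃) (b₁≤b₂ : b₁ ≤ b₂) (b₂≤b₃ : b₂ ≤ b₃)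
    (a₁≤b₃ : a₁ ≤ b₃) (b₁≤a₃ : b₁ ≤ a₃)
    (a₁≰b₂ : ¬ a₁ ≤ b₂) (b₁≰a₂ : ¬ b₁ ≤ a₂) (a₂≰b₃ : ¬ a₂ ≤ b₃) (b₂≰a₃ : ¬ b₂ ≤ a₃)
    where

    p q : Carrier
    p = a₂ ∧ b₃
    q = a₃ ∧ b₂

    image : L15 → Carrier
    image `0 = a₂ ∧ b₂
    image `h = p
    image `i = q
    image `e = a₂
    image `f = p ∨ q
    image `g = b₂
    image `d = (a₂ ∨ q) ∧ (b₂ ∨ p)
    image `b = a₂ ∨ q
    image `c = b₂ ∨ p
    image `1 = a₂ ∨ b₂

    0≤h : image `0 ≤ image `h
    0≤h = ∧-greatest (x∧y≤x _ _) (trans (x∧y≤y _ _) b₂≤b₃)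

    0≤i : image `0 ≤ image `i
    0≤i = ∧-greatest (trans (x∧y≤x _ _) a₂≤a₃) (x∧y≤y _ _)

    h≤e : image `h ≤ image `e
    h≤e = x∧y≤x _ _

    i≤g : image `i ≤ image `g
    i≤g = x∧y≤y _ _

    e≤b : image `e ≤ image `b
    e≤b = x≤x∨y _ _

    g≤c : image `g ≤ image `c
    g≤c = x≤x∨y _ _

    f≤d : image `f ≤ image `d
    f≤d = ∨-least (∧-greatest (trans h≤e e≤b) (y≤x∨y _ _))
                  (∧-greatest (y≤x∨y _ _) (trans i≤g g≤c))

    b≤1 : image `b ≤ image `1
    b≤1 = ∨-least (x≤x∨y _ _) (trans i≤g (y≤x∨y _ _))

    c≤1 : image `c ≤ image `1
    c≤1 = ∨-least (y≤x∨y _ _) (trans h≤e (x≤x∨y _ _))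

    b≤a₃ : image `b ≤ a₃
    b≤a₃ = ∨-least a₂≤a₃ (x∧y≤x _ _)

    c≤b₃ : image `c ≤ b₃
    c≤b₃ = ∨-least b₂≤b₃ (x∧y≤y _ _)

    h≰g : ¬ image `h ≤ image `g
    h≰g h≤g = a₁≰b₂ (trans (∧-greatest a₁≤a₂ a₁≤b₃) h≤g)

    i≰e : ¬ image `i ≤ image `e
    i≰e i≤e = b₁≰a₂ (trans (∧-greatest b₁≤a₃ b₁≤b₂) i≤e)

    e≰c : ¬ image `e ≤ image `c
    e≰c e≤c = a₂≰b₃ (trans e≤c c≤b₃)

    g≰b : ¬ image `g ≤ image `b
    g≰b g≤b = b₂≰a₃ (trans g≤b b≤a₃)

    d≰f : ¬ image `d ≤ image `f
    d≰f d≤f = no-doubly-reducible (image `f)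
      ( image `h , image `i , image `b , image `c
      , ((λ h≤i → h≰g (trans h≤i i≤g)) , (λ i≤h → i≰e (trans i≤h h≤e)))
      , ((λ b≤c → e≰c (trans e≤b b≤c)) , (λ c≤b → g≰b (trans g≤c c≤b)))
      , Eq.refl
      , antisym f≤d d≤f )

    criterion : L15EmbeddingCriterion L image
    criterion = record
      { covers-preserved = λ
          { `0 → 0≤h ∷ 0≤i ∷ []
          ; `h → h≤e ∷ x≤x∨y _ _ ∷ []
          ; `i → y≤x∨y _ _ ∷ i≤g ∷ []
          ; `e → e≤b ∷ []
          ; `f → f≤d ∷ []
          ; `g → g≤c ∷ []
          ; `d → x∧y≤x _ _ ∷ x∧y≤y _ _ ∷ []
          ; `b → b≤1 ∷ []
          ; `c → c≤1 ∷ []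
          ; `1 → []
          }
      ; joinBasis-bounded = ≤-refl ∷ ≤-refl ∷ ≤-refl ∷ ≤-refl ∷ []
      ; meetBasis-bounded =
          ≤-refl ∷ ≤-refl
          ∷ ∧-greatest (x∧y≤x _ _) (trans (x∧y≤y _ _) c≤b₃)
          ∷ ∧-greatest (trans (x∧y≤x _ _) b≤a₃) (x∧y≤y _ _) ∷ []
      ; pairs-separated = h≰g ∷ i≰e ∷ e≰c ∷ g≰b ∷ d≰f ∷ []
      }

    l15-embedding : L15Embedding L
    l15-embedding = criterion⇒embedding L image criterion

lemma3p1 : {c ℓ₁ ℓ₂ : Level} (L : Lattice c ℓ₁ ℓ₂) →
    NoDoublyReducible L →
    (a₁ a₂ a₃ b₁ b₂ b₃ : Lattice.Carrier L) →
    let open Lattice L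
        _<_ = _<L_ L
        _∥'_ = _∥_ L
    in
    ¬ (a₁ ≈ a₂) → ¬ (a₁ ≈ a₃) → ¬ (a₁ ≈ b₁) → ¬ (a₁ ≈ b₂) → ¬ (a₁ ≈ b₃) →
    ¬ (a₂ ≈ a₃) → ¬ (a₂ ≈ b₁) → ¬ (a₂ ≈ b₂) → ¬ (a₂ ≈ b₃) →
    ¬ (a₃ ≈ b₁) → ¬ (a₃ ≈ b₂) → ¬ (a₃ ≈ b₃) →
    ¬ (b₁ ≈ b₂) → ¬ (b₁ ≈ b₃) →
    ¬ (b₂ ≈ b₃) →
    a₁ < a₂ → a₂ < a₃ → b₁ < b₂ → b₂ < b₃ → a₁ < b₃ → b₁ < a₃ →
    a₂ ∥' b₁ → a₂ ∥' b₂ → a₂ ∥' b₃ →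
    a₁ ∥' b₂ → a₃ ∥' b₂ →
    (a₂ ∨ b₂) ≈ (a₃ ∨ b₃) →
    (a₂ ∧ b₂) ≈ (a₁ ∧ b₁) →
    HasL15Sublattice L
lemma3p1 L no-doubly-reducible a₁ a₂ a₃ b₁ b₂ b₃ _ _ _ _ _ _ _ _ _ _ _ _ _ _ _
  (a₁≤a₂ , _) (a₂≤a₃ , _) (b₁≤b₂ , _) (b₂≤b₃ , _) (a₁≤b₃ , _) (b₁≤a₃ , _)
  (_ , b₁≰a₂) _ (a₂≰b₃ , _) (a₁≰b₂ , _) (_ , b₂≰a₃) _ _ =
  CrossingChains.l15-embedding L no-doubly-reducible
    a₁≤a₂ a₂≤a₃ b₁≤b₂ b₂≤b₃ a₁≤b₃ b₁≤a₃ a₁≰b₂ b₁≰a₂ a₂≰b₃ b₂≰a₃
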